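{- Let $G$ be a graph, $k,\ell\ge1$, and let $J_0,J_1,\dots,J_\ell$ be independent sets of $G$ with $J_0=S$ where $S$ is an independent set of size $k$. Define collections $\mathcal{C}_0,\dots,\mathcal{C}_\ell$ as follows: $\mathcal{C}_0=\{\{(S,k)\}\}$, and for $i\in\{1,\dots,\ell\}$, $\mathcal{C}_i$ contains, for every $C\in\mathcal{C}_{i-1}$ and every constraint $(X,b)\in C$, the constraint set $C'$ consisting of: $(N(X)\cap J_i,1)$; the constraint $(X\cap J_i,b-1)$ if $b\ge2$ (nothing if $b=1$); and $(X'\cap J_i,b')$ for every other constraint $(X',b')\in C$. Then for every $i\in\{0,\dots,\ell\}$ and every $C\in\mathcal{C}_i$, the vertex sets appearing in the constraints of $C$ are pairwise disjoint.
   Context: A constraint is a pair $(X,b)$ with $X\subseteq V(G)$ and $b$ a positive integer; a constraint set is a collection of constraints. For $X\subseteq V(G)$, $N(X)=\{v\notin X: v \text{ adjacent to some } u\in X\}$ is the open neighborhood. A set of vertices is independent if its vertices are pairwise non-adjacent. -}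

module Defs where

open import Data.Nat using (ℕ; zero; suc; _≤_; _∸_)
open import Data.Bool using (Bool; true; false; not; _∧_; if_then_else_)
open import Data.Fin using (Fin)
open import Data.Fin.Subset using (Subset; _∈_; _∩_; ∣_∣)
open import Data.Vec using (tabulate; lookup)
open import Data.Bool.ListAction using (or)
open import Data.List using (List; []; _∷_; _++_; map; concatMap; allFin)
open import Data.List.Relation.Unary.AllPairs using (AllPairs)
open import Data.Product using (_×_; _,_; proj₁; proj₂)
open import Data.Empty using (⊥)
open import Relation.Binary.PropositionalEquality using (_≡_)

record Graph (n : ℕ) : Set where
  field
    adj     : Fin n → Fin n → Bool
    adj-sym : ∀ u v → adj u v ≡ adj v u
    irrefl  : ∀ v → adj v v ≡ false
open Graph public

Independent : ∀ {n} → Graph n → Subset n → Set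
Independent G J = ∀ u v → u ∈ J → v ∈ J → adj G u v ≡ false

N : ∀ {n} → Graph n → Subset n → Subset n
N {n} G X = tabulate λ v →
  not (lookup X v) ∧ or (map (λ u → lookup X u ∧ adj G u v) (allFin n))

Constraint : ℕ → Set
Constraint n = Subset n × ℕ

ConstraintSet : ℕ → Set
ConstraintSet n = List (Constraint n)

picks : ∀ {A : Set} → List A → List (A × List A)
picks [] = []
picks (x ∷ xs) = (x , xs) ∷ map (λ p → proj₁ p , x ∷ proj₂ p) (picks xs)

branch : ∀ {n} → Graph n → Subset n → Constraint n → ConstraintSet n → ConstraintSet n
branch G J (X , b) others =
  (N G X ∩ J , 1) ∷
  ((decr b) ++ map (λ c → proj₁ c ∩ J , proj₂ c) others)
  where
  decr : ℕ → ConstraintSet _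
  decr 0 = []
  decr 1 = []
  decr (suc (suc m)) = (X ∩ J , suc m) ∷ []

step : ∀ {n} → Graph n → Subset n → List (ConstraintSet n) → List (ConstraintSet n)
step G J Cs = concatMap (λ C → map (λ p → branch G J (proj₁ p) (proj₂ p)) (picks C)) Cs

Coll : ∀ {n} → Graph n → (ℕ → Subset n) → Subset n → ℕ → ℕ → List (ConstraintSet n)
Coll G J S k zero = ((S , k) ∷ []) ∷ []
Coll G J S k (suc i) = step G (J (suc i)) (Coll G J S k i)

Disjoint : ∀ {n} → Subset n → Subset n → Set
Disjoint X Y = ∀ v → v ∈ X → v ∈ Y → ⊥

-- vertex sets of the constraints (at distinct positions) are pairwise disjoint
PairwiseDisjoint : ∀ {n} → ConstraintSet n → Set
PairwiseDisjoint C = AllPairs (λ c c' → Disjoint (proj₁ c) (proj₁ c')) C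

module Submission where

open import Defs
open import Data.Nat using (ℕ; _≤_; _<_; zero; suc)
open import Data.Nat.Properties using (<⇒≤)
open import Data.Fin using (Fin)
open import Data.Fin.Subset using (Subset; ∣_∣; _∩_; _⊆_) renaming (_∈_ to _∈ₛ_)
open import Data.Fin.Subset.Properties using (⊆-refl; ⊆-reflexive; x∈p∩q⁻; p∩q⊆q)
open import Data.Bool using (true; T; _∧_)
open import Data.Bool.ListAction using (any)
open import Data.Bool.Properties using (T-≡; T-∧)
open import Data.Vec using (lookup)
open import Data.Vec.Properties using (lookup∘tabulate; []=⇒lookup; lookup⇒[]=)
open import Data.List using (List; []; _∷_; map; allFin)
open import Data.List.Membership.Propositional using () renaming (_∈_ to _∈L_)
open import Data.List.Relation.Unary.Any using (satisfied)
open import Data.List.Relation.Unary.Any.Properties using (any⁻)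
open import Data.List.Relation.Unary.All as All using (All; []; _∷_)
import Data.List.Relation.Unary.All.Properties as All
open import Data.List.Relation.Unary.AllPairs as AllPairs using (AllPairs; []; _∷_)
import Data.List.Relation.Unary.AllPairs.Properties as AllPairs
open import Data.Product using (∃; _×_; _,_; proj₁; proj₂)
open import Function using (_∘_; Equivalence)
open import Relation.Binary using (Rel; Symmetric)
open import Relation.Binary.PropositionalEquality using (_≡_; sym; trans)

-- Strengthen the claim: every vertex set of a constraint set in 𝒞ᵢ also lies in Jᵢ.
-- Branching on (X,b) with X ⊆ Jᵢ₋₁ creates N(X) ∩ Jᵢ; since Jᵢ₋₁ is independent, N(X)
-- misses all of Jᵢ₋₁ and hence every old vertex set, while intersecting the old, already
-- disjoint sets with Jᵢ keeps them disjoint.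

private
  variable
    n : ℕ

Disjoint-sym : Symmetric (Disjoint {n})
Disjoint-sym X∩Y=∅ v v∈Y v∈X = X∩Y=∅ v v∈X v∈Y

Disjoint-mono : {X X′ Y Y′ : Subset n} → X′ ⊆ X → Y′ ⊆ Y → Disjoint X Y → Disjoint X′ Y′
Disjoint-mono X′⊆X Y′⊆Y X∩Y=∅ v v∈X′ v∈Y′ = X∩Y=∅ v (X′⊆X v∈X′) (Y′⊆Y v∈Y′)

Disjoint-∩ : {X Y : Subset n} (J : Subset n) → Disjoint X Y → Disjoint (X ∩ J) (Y ∩ J)
Disjoint-∩ {X = X} {Y} J = Disjoint-mono (proj₁ ∘ x∈p∩q⁻ X J) (proj₁ ∘ x∈p∩q⁻ Y J)

∈N⇒adjacent : (G : Graph n) {X : Subset n} {v : Fin n} → v ∈ₛ N G X →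
              ∃ λ u → u ∈ₛ X × adj G u v ≡ true
∈N⇒adjacent {n} G {X} {v} v∈NX =
  u , lookup⇒[]= u X (Equivalence.to T-≡ u∈X) , Equivalence.to T-≡ u~v
  where
  any-neighbour : T (any (λ u → lookup X u ∧ adj G u v) (allFin n))
  any-neighbour = proj₂ (Equivalence.to T-∧ (Equivalence.from T-≡
                    (trans (sym (lookup∘tabulate _ v)) ([]=⇒lookup v∈NX))))
  witness : ∃ λ u → T (lookup X u ∧ adj G u v)
  witness = satisfied (any⁻ _ (allFin n) any-neighbour)
  u : Fin n
  u = proj₁ witness
  u∈X : T (lookup X u)
  u∈X = proj₁ (Equivalence.to T-∧ (proj₂ witness))
  u~v : T (adj G u v)
  u~v = proj₂ (Equivalence.to T-∧ (proj₂ witness))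

N-disjoint-independent : (G : Graph n) {J X : Subset n} →
                         Independent G J → X ⊆ J → Disjoint (N G X) J
N-disjoint-independent G J-indep X⊆J v v∈NX v∈J
  with u , u∈X , u~v ← ∈N⇒adjacent G v∈NX
  with () ← trans (sym u~v) (J-indep _ v (X⊆J u∈X) v∈J)

module _ {A : Set} where

  picks-All : {P : A → Set} {xs : List A} →
              All P xs → All (λ p → All P (proj₁ p ∷ proj₂ p)) (picks xs)
  picks-All []         = []
  picks-All (px ∷ pxs) =
    (px ∷ pxs) ∷ All.map⁺ (All.map (λ { (py ∷ pys) → py ∷ px ∷ pys }) (picks-All pxs))

  picks-AllPairs : {R : Rel A _} → Symmetric R → {xs : List A} →
                   AllPairs R xs → All (λ p → AllPairs R (proj₁ p ∷ proj₂ p)) (picks xs)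
  picks-AllPairs R-sym []            = []
  picks-AllPairs {R} R-sym {x ∷ _} (rx ∷ rxs) =
    (rx ∷ rxs) ∷ All.map⁺ (All.zipWith insert-x (picks-All rx , picks-AllPairs R-sym rxs))
    where
    insert-x : {y : A} {ys : List A} →
               All (R x) (y ∷ ys) × AllPairs R (y ∷ ys) → AllPairs R (y ∷ x ∷ ys)
    insert-x (rxy ∷ rxys , ry ∷ rys) = (R-sym rxy ∷ ry) ∷ rxys ∷ rys

restrict : Subset n → Constraint n → Constraint n
restrict J c = proj₁ c ∩ J , proj₂ c

Within : Subset n → ConstraintSet n → Set
Within J = All (λ c → proj₁ c ⊆ J)

Valid : Subset n → ConstraintSet n → Set
Valid J C = PairwiseDisjoint C × Within J C

restrict-within : (J : Subset n) (C : ConstraintSet n) → Within J (map (restrict J) C)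
restrict-within J C = All.map⁺ (All.universal (λ c {_} → p∩q⊆q (proj₁ c) J) C)

restrict-pairwiseDisjoint : (J : Subset n) {C : ConstraintSet n} →
                            PairwiseDisjoint C → PairwiseDisjoint (map (restrict J) C)
restrict-pairwiseDisjoint J = AllPairs.map⁺ ∘ AllPairs.map (Disjoint-∩ J)

module _ (G : Graph n) {J₀ : Subset n} (J₀-indep : Independent G J₀) (J : Subset n) where

  N-restrict-disjoint : {X : Subset n} {C : ConstraintSet n} → X ⊆ J₀ → Within J₀ C →
                        All (λ c → Disjoint (N G X ∩ J) (proj₁ c)) (map (restrict J) C)
  N-restrict-disjoint {X} X⊆J₀ = All.map⁺ ∘ All.map (λ {c} → misses-N {proj₁ c})
    where
    misses-N : {Y : Subset n} → Y ⊆ J₀ → Disjoint (N G X ∩ J) (Y ∩ J)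
    misses-N Y⊆J₀ = Disjoint-∩ J (Disjoint-mono ⊆-refl Y⊆J₀
                                     (N-disjoint-independent G J₀-indep X⊆J₀))

  branch-pairwiseDisjoint : {c : Constraint n} {others : ConstraintSet n} →
                            Valid J₀ (c ∷ others) → PairwiseDisjoint (branch G J c others)
  branch-pairwiseDisjoint {_ , zero} (_ ∷ pd , X⊆J₀ ∷ within) =
    N-restrict-disjoint X⊆J₀ within ∷ restrict-pairwiseDisjoint J pd
  branch-pairwiseDisjoint {_ , suc zero} (_ ∷ pd , X⊆J₀ ∷ within) =
    N-restrict-disjoint X⊆J₀ within ∷ restrict-pairwiseDisjoint J pd
  branch-pairwiseDisjoint {_ , suc (suc _)} (Xpd ∷ pd , X⊆J₀ ∷ within) =
    N-restrict-disjoint X⊆J₀ (X⊆J₀ ∷ within) ∷ restrict-pairwiseDisjoint J (Xpd ∷ pd)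

  branch-within : (c : Constraint n) (others : ConstraintSet n) → Within J (branch G J c others)
  branch-within (X , zero)          others = p∩q⊆q _ J ∷ restrict-within J others
  branch-within (X , suc zero)      others = p∩q⊆q _ J ∷ restrict-within J others
  branch-within (X , suc (suc b))   others = p∩q⊆q _ J ∷ restrict-within J ((X , suc b) ∷ others)

  step-valid : {Cs : List (ConstraintSet n)} → All (Valid J₀) Cs → All (Valid J) (step G J Cs)
  step-valid = All.concat⁺ ∘ All.map⁺ ∘ All.map branches-valid
    where
    branches-valid : {C : ConstraintSet n} → Valid J₀ C →
                     All (Valid J) (map (λ p → branch G J (proj₁ p) (proj₂ p)) (picks C))
    branches-valid (pd , within) =
      All.map⁺ (All.zipWith (λ { {c , others} valid →
                                   branch-pairwiseDisjoint valid , branch-within c others })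
                            (picks-AllPairs (Disjoint-sym {n}) pd , picks-All within))

Coll-valid : (G : Graph n) (J : ℕ → Subset n) (S : Subset n) (k ℓ : ℕ) → S ⊆ J 0 →
             (∀ i → i < ℓ → Independent G (J i)) →
             ∀ i → i ≤ ℓ → All (Valid (J i)) (Coll G J S k i)
Coll-valid G J S k ℓ S⊆J₀ J-indep zero    _     = ([] ∷ [] , S⊆J₀ ∷ []) ∷ []
Coll-valid G J S k ℓ S⊆J₀ J-indep (suc i) 1+i≤ℓ =
  step-valid G (J-indep i 1+i≤ℓ) (J (suc i))
    (Coll-valid G J S k ℓ S⊆J₀ J-indep i (<⇒≤ 1+i≤ℓ))

lemma3p3 : ∀ {n} (G : Graph n) (k ℓ : ℕ) → 1 ≤ k → 1 ≤ ℓ →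
    (S : Subset n) → Independent G S → ∣ S ∣ ≡ k →
    (J : ℕ → Subset n) → (∀ i → i ≤ ℓ → Independent G (J i)) → J 0 ≡ S →
    ∀ i → i ≤ ℓ → ∀ C → C ∈L Coll G J S k i → PairwiseDisjoint C
-- Only J₀ ⊇ S and the independence of J₀, …, Jℓ₋₁ matter; the hypotheses on k and S are unused.
lemma3p3 G k ℓ _ _ S _ _ J J-indep J₀≡S i i≤ℓ C C∈𝒞ᵢ =
  proj₁ (All.lookup (Coll-valid G J S k ℓ (⊆-reflexive (sym J₀≡S))
                                (λ j j<ℓ → J-indep j (<⇒≤ j<ℓ)) i i≤ℓ) C∈𝒞ᵢ)
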